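{- Let $S$ be a $\mathsf{TOTO}$-definable sorting operator. Then for any set $\mathcal{T}$ of permutations definable in $\mathsf{TOTO}$, the set $S^{ -1}(\mathcal{T})=\{\sigma : S(\sigma)\in\mathcal{T}\}$ is also definable in $\mathsf{TOTO}$. In particular, for every fixed positive integer $k$ there is a $\mathsf{TOTO}$ sentence whose models are exactly the $S$-$k$-sortable permutations.
   Context: A permutation $\sigma$ of size $n$ is identified with the finite structure whose domain is $A^\sigma=\{(i,\sigma(i)) : 1\le i\le n\}$, equipped with the position order $<_P$ (comparing first coordinates) and the value order $<_V$ (comparing second coordinates). $\mathsf{TOTO}$ is first-order logic (with equality) over the signature of two binary relation symbols $<_P,<_V$ interpreted in this way. A set $\mathcal{T}$ of permutations is definable in $\mathsf{TOTO}$ if there is a $\mathsf{TOTO}$ sentence whose models (among permutations) are exactly the elements of $\mathcal{T}$. A sorting operator is a size-preserving map $S$ from permutations to permutations; since $S(\sigma)$ is a rearrangement of the values of $\sigma$, identifying each element of $\sigma$ with its value, $S(\sigma)$ is the same set of elements with the same value order $\prec_V$ but a new position order $\prec_{S(P)}$ ($a\prec_{S(P)}b$ iff the value of $a$ appears before the value of $b$ in the one-line notation of $S(\sigma)$). $S$ is $\mathsf{TOTO}$-definable if there is a $\mathsf{TOTO}$ formula $\phi_{SP}(x,y)$ with two free variables such that for all permutations $\sigma$ and elements $a,b$ of $\sigma$, $a\prec_{S(P)}b$ iff $(\sigma,a,b)\models\phi_{SP}(x,y)$. Let $\mathcal{I}=\{12\cdots n : n\ge1\}$ be the set of increasing permutations;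 the $S$-$k$-sortable permutations are those in $S^{ -k}(\mathcal{I})$, i.e. those $\sigma$ with $S^k(\sigma)$ increasing. -}

module Defs where

open import Data.Nat using (ℕ; zero; suc; _≥_)
open import Data.Fin using (Fin; zero; suc; _<_)
open import Data.Fin.Permutation using (Permutation′; _⟨$⟩ʳ_; _⟨$⟩ˡ_)
open import Data.Product using (Σ; ∃; _×_)
open import Data.Sum using (_⊎_)
open import Data.Empty using (⊥)
open import Relation.Nullary using (¬_)
open import Relation.Binary.PropositionalEquality using (_≡_)
open import Function.Bundles using (_⇔_)

-- A permutation σ of size n is a bijection Fin n → Fin n; σ ⟨$⟩ʳ i is the
-- value at position i.  The elements of the structure are the positions
-- i : Fin n (standing for the point (i, σ(i))).

data Formula : ℕ → Set where
  _≐_  : ∀ {m} → Fin m → Fin m → Formula m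
  _<P_ : ∀ {m} → Fin m → Fin m → Formula m
  _<V_ : ∀ {m} → Fin m → Fin m → Formula m
  ⊥f   : ∀ {m} → Formula m
  ¬f_  : ∀ {m} → Formula m → Formula m
  _∧f_ : ∀ {m} → Formula m → Formula m → Formula m
  _∨f_ : ∀ {m} → Formula m → Formula m → Formula m
  _⇒f_ : ∀ {m} → Formula m → Formula m → Formula m
  ∃f   : ∀ {m} → Formula (suc m) → Formula m
  ∀f   : ∀ {m} → Formula (suc m) → Formula m

Sentence : Set
Sentence = Formula 0

extend : ∀ {m n} → Fin n → (Fin m → Fin n) → Fin (suc m) → Fin n
extend a ρ zero    = a
extend a ρ (suc x) = ρ x

Sat : ∀ {m n} → Permutation′ n → (Fin m → Fin n) → Formula m → Set
Sat σ ρ (x ≐ y)  = ρ x ≡ ρ y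
Sat σ ρ (x <P y) = ρ x < ρ y
Sat σ ρ (x <V y) = (σ ⟨$⟩ʳ ρ x) < (σ ⟨$⟩ʳ ρ y)
Sat σ ρ ⊥f       = ⊥
Sat σ ρ (¬f φ)   = ¬ Sat σ ρ φ
Sat σ ρ (φ ∧f ψ) = Sat σ ρ φ × Sat σ ρ ψ
Sat σ ρ (φ ∨f ψ) = Sat σ ρ φ ⊎ Sat σ ρ ψ
Sat σ ρ (φ ⇒f ψ) = Sat σ ρ φ → Sat σ ρ ψ
Sat σ ρ (∃f φ)   = Σ (Fin _) (λ a → Sat σ (extend a ρ) φ)
Sat σ ρ (∀f φ)   = (a : Fin _) → Sat σ (extend a ρ) φ

noVars : ∀ {n} → Fin 0 → Fin n
noVars ()

Models : ∀ {n} → Permutation′ n → Sentence → Set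
Models σ φ = Sat σ noVars φ

PermSet : Set₁
PermSet = ∀ {n} → Permutation′ n → Set

Definable : PermSet → Set
Definable T = Σ Sentence (λ φ → ∀ n (σ : Permutation′ n) → T σ ⇔ Models σ φ)

SortingOp : Set
SortingOp = ∀ {n} → Permutation′ n → Permutation′ n

-- new position order: a ≺_{S(P)} b iff the value of a appears before the
-- value of b in S(σ), i.e. S(σ)⁻¹(σ a) < S(σ)⁻¹(σ b).
SPrec : SortingOp → ∀ {n} → Permutation′ n → Fin n → Fin n → Set
SPrec S σ a b = (S σ ⟨$⟩ˡ (σ ⟨$⟩ʳ a)) < (S σ ⟨$⟩ˡ (σ ⟨$⟩ʳ b))

pair : ∀ {n} → Fin n → Fin n → Fin 2 → Fin n
pair a b zero       = a
pair a b (suc zero) = b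

DefinableOp : SortingOp → Set
DefinableOp S = Σ (Formula 2) (λ φ → ∀ n (σ : Permutation′ n) (a b : Fin n) →
  SPrec S σ a b ⇔ Sat σ (pair a b) φ)

preimage : SortingOp → PermSet → PermSet
preimage S T σ = T (S σ)

iterate : ℕ → SortingOp → SortingOp
iterate zero    S σ = σ
iterate (suc k) S σ = S (iterate k S σ)

Increasing : PermSet
Increasing {n} σ = n ≥ 1 × (∀ i → σ ⟨$⟩ʳ i ≡ i)

Sortable : SortingOp → ℕ → PermSet
Sortable S k = preimage (iterate k S) Increasing

-- A TOTO formula about S(σ) is read inside σ by replacing every atom x <P y
-- with φ_SP(x, y): the elements keep their values, and the map sending an
-- element to its position in S(σ) is an isomorphism from σ equipped with the
-- order defined by φ_SP onto S(σ).  Iterating gives S^{-k}(𝓘), and 𝓘 itself is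
-- defined by "nonempty, and <P implies <V", since a strictly increasing
-- permutation of Fin n is the identity.

module Submission where

open import Defs
open import Data.Empty using (⊥-elim)
open import Data.Fin using (Fin; zero; suc; _≤_; _<_; inject₁; lift)
open import Data.Fin.Induction using (<-weakInduction)
open import Data.Fin.Permutation
  using (Permutation′; _⟨$⟩ʳ_; _⟨$⟩ˡ_; inverseˡ; inverseʳ; id; flip; _∘ₚ_)
open import Data.Fin.Properties
  using (≤-refl; ≤-antisym; <-irrefl; <-asym; <-cmp; toℕ-inject₁; ≤̄⇒inject₁<)
open import Data.Nat using (ℕ; zero; suc; _≥_; s≤s; z≤n)
import Data.Nat.Properties as ℕ
open import Data.Product using (Σ; _×_; _,_)
open import Data.Product.Function.Dependent.Propositional using (Σ-⇔)
open import Data.Product.Function.NonDependent.Propositional using (_×-⇔_)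
open import Data.Sum.Function.Propositional using (_⊎-⇔_)
open import Function.Base using (_∘_)
open import Function.Bundles using (_⇔_; mk⇔; Equivalence; Injection)
open import Function.Construct.Identity using (⇔-id)
open import Function.Construct.Symmetry using (⇔-sym)
open import Function.Properties.Equivalence using () renaming (trans to ⇔-trans)
open import Function.Properties.Inverse using (↔⇒↠; ↔⇒↣)
open import Function.Related.Propositional using (module EquationalReasoning)
open import Function.Related.TypeIsomorphisms using (→-cong-⇔; ¬-cong-⇔)
open import Relation.Binary using (tri<; tri≈; tri>; _Preserves_⟶_)
open import Relation.Binary.PropositionalEquality
  using (_≡_; _≗_; refl; sym; trans; cong; subst; subst₂)

open Equivalence using (to; from)

private
  variable
    m k n : ℕ

subst₂-⇔ : ∀ {A B : Set} (R : A → B → Set) {x x′ y y′} →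
  x ≡ x′ → y ≡ y′ → R x y ⇔ R x′ y′
subst₂-⇔ R refl refl = ⇔-id _

∃-cong-⇔ : {A B : Fin n → Set} (π : Permutation′ n) →
  (∀ a → A a ⇔ B (π ⟨$⟩ʳ a)) → Σ (Fin n) A ⇔ Σ (Fin n) B
∃-cong-⇔ π A⇔B = Σ-⇔ (↔⇒↠ π) (A⇔B _)

∀-cong-⇔ : {A B : Fin n → Set} (π : Permutation′ n) →
  (∀ a → A a ⇔ B (π ⟨$⟩ʳ a)) → (∀ a → A a) ⇔ (∀ b → B b)
∀-cong-⇔ {B = B} π A⇔B = mk⇔
  (λ f b → subst B (inverseʳ π) (to (A⇔B (π ⟨$⟩ˡ b)) (f (π ⟨$⟩ˡ b))))
  (λ g a → from (A⇔B a) (g (π ⟨$⟩ʳ a)))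

rename : (Fin m → Fin k) → Formula m → Formula k
rename r (x ≐ y)  = r x ≐ r y
rename r (x <P y) = r x <P r y
rename r (x <V y) = r x <V r y
rename r ⊥f       = ⊥f
rename r (¬f φ)   = ¬f rename r φ
rename r (φ ∧f ψ) = rename r φ ∧f rename r ψ
rename r (φ ∨f ψ) = rename r φ ∨f rename r ψ
rename r (φ ⇒f ψ) = rename r φ ⇒f rename r ψ
rename r (∃f φ)   = ∃f (rename (lift 1 r) φ)
rename r (∀f φ)   = ∀f (rename (lift 1 r) φ)

extend-lift : (r : Fin m → Fin k) {ρ : Fin k → Fin n} {ρ′ : Fin m → Fin n} →
  ρ′ ≗ ρ ∘ r → ∀ a → extend a ρ′ ≗ extend a ρ ∘ lift 1 r
extend-lift r h a zero    = refl
extend-lift r h a (suc i) = h i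

Sat-rename : (σ : Permutation′ n) (r : Fin m → Fin k)
  {ρ : Fin k → Fin n} {ρ′ : Fin m → Fin n} → ρ′ ≗ ρ ∘ r →
  (φ : Formula m) → Sat σ ρ (rename r φ) ⇔ Sat σ ρ′ φ
Sat-rename σ r h (x ≐ y)  = subst₂-⇔ _≡_ (sym (h x)) (sym (h y))
Sat-rename σ r h (x <P y) = subst₂-⇔ _<_ (sym (h x)) (sym (h y))
Sat-rename σ r h (x <V y) =
  subst₂-⇔ (λ a b → σ ⟨$⟩ʳ a < σ ⟨$⟩ʳ b) (sym (h x)) (sym (h y))
Sat-rename σ r h ⊥f       = ⇔-id _
Sat-rename σ r h (¬f φ)   = ¬-cong-⇔ (Sat-rename σ r h φ)
Sat-rename σ r h (φ ∧f ψ) = Sat-rename σ r h φ ×-⇔ Sat-rename σ r h ψ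
Sat-rename σ r h (φ ∨f ψ) = Sat-rename σ r h φ ⊎-⇔ Sat-rename σ r h ψ
Sat-rename σ r h (φ ⇒f ψ) = →-cong-⇔ (Sat-rename σ r h φ) (Sat-rename σ r h ψ)
Sat-rename σ r h (∃f φ)   = ∃-cong-⇔ id λ a → Sat-rename σ (lift 1 r) (extend-lift r h a) φ
Sat-rename σ r h (∀f φ)   = ∀-cong-⇔ id λ a → Sat-rename σ (lift 1 r) (extend-lift r h a) φ

extend-map : ∀ {n′} (f : Fin n → Fin n′) {ρ : Fin m → Fin n} {ρ′ : Fin m → Fin n′} →
  ρ′ ≗ f ∘ ρ → ∀ a → extend (f a) ρ′ ≗ f ∘ extend a ρ
extend-map f h a zero    = refl
extend-map f h a (suc i) = h i

interpret : Formula 2 → Formula m → Formula m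
interpret φ< (x ≐ y)  = x ≐ y
interpret φ< (x <P y) = rename (pair x y) φ<
interpret φ< (x <V y) = x <V y
interpret φ< ⊥f       = ⊥f
interpret φ< (¬f ψ)   = ¬f interpret φ< ψ
interpret φ< (ψ ∧f χ) = interpret φ< ψ ∧f interpret φ< χ
interpret φ< (ψ ∨f χ) = interpret φ< ψ ∨f interpret φ< χ
interpret φ< (ψ ⇒f χ) = interpret φ< ψ ⇒f interpret φ< χ
interpret φ< (∃f ψ)   = ∃f (interpret φ< ψ)
interpret φ< (∀f ψ)   = ∀f (interpret φ< ψ)

module _ (φ< : Formula 2) (σ τ π : Permutation′ n)
         (π-preserves-values : ∀ a → τ ⟨$⟩ʳ (π ⟨$⟩ʳ a) ≡ σ ⟨$⟩ʳ a)
         (φ<-defines-π-order : ∀ a b → (π ⟨$⟩ʳ a < π ⟨$⟩ʳ b) ⇔ Sat σ (pair a b) φ<)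
         where

  Sat-interpret : {ρ ρ′ : Fin m → Fin n} → ρ′ ≗ (π ⟨$⟩ʳ_) ∘ ρ →
    (ψ : Formula m) → Sat σ ρ (interpret φ< ψ) ⇔ Sat τ ρ′ ψ
  Sat-interpret {ρ = ρ} {ρ′} h (x ≐ y) = begin
    ρ x ≡ ρ y                     ∼⟨ mk⇔ (cong (π ⟨$⟩ʳ_)) (Injection.injective (↔⇒↣ π)) ⟩
    π ⟨$⟩ʳ ρ x ≡ π ⟨$⟩ʳ ρ y       ∼⟨ subst₂-⇔ _≡_ (sym (h x)) (sym (h y)) ⟩
    ρ′ x ≡ ρ′ y                   ∎
    where open EquationalReasoning
  Sat-interpret {ρ = ρ} {ρ′} h (x <P y) = begin
    Sat σ ρ (rename (pair x y) φ<)   ∼⟨ Sat-rename σ (pair x y) pair-ρ φ< ⟩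
    Sat σ (pair (ρ x) (ρ y)) φ<      ∼⟨ ⇔-sym (φ<-defines-π-order (ρ x) (ρ y)) ⟩
    π ⟨$⟩ʳ ρ x < π ⟨$⟩ʳ ρ y          ∼⟨ subst₂-⇔ _<_ (sym (h x)) (sym (h y)) ⟩
    ρ′ x < ρ′ y                      ∎
    where
    open EquationalReasoning
    pair-ρ : pair (ρ x) (ρ y) ≗ ρ ∘ pair x y
    pair-ρ zero       = refl
    pair-ρ (suc zero) = refl
  Sat-interpret {ρ = ρ} {ρ′} h (x <V y) =
    subst₂-⇔ _<_ (same-value x) (same-value y)
    where
    same-value : ∀ i → σ ⟨$⟩ʳ ρ i ≡ τ ⟨$⟩ʳ ρ′ i
    same-value i = sym (trans (cong (τ ⟨$⟩ʳ_) (h i)) (π-preserves-values (ρ i)))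
  Sat-interpret h ⊥f       = ⇔-id _
  Sat-interpret h (¬f ψ)   = ¬-cong-⇔ (Sat-interpret h ψ)
  Sat-interpret h (ψ ∧f χ) = Sat-interpret h ψ ×-⇔ Sat-interpret h χ
  Sat-interpret h (ψ ∨f χ) = Sat-interpret h ψ ⊎-⇔ Sat-interpret h χ
  Sat-interpret h (ψ ⇒f χ) = →-cong-⇔ (Sat-interpret h ψ) (Sat-interpret h χ)
  Sat-interpret h (∃f ψ)   = ∃-cong-⇔ π λ a → Sat-interpret (extend-map (π ⟨$⟩ʳ_) h a) ψ
  Sat-interpret h (∀f ψ)   = ∀-cong-⇔ π λ a → Sat-interpret (extend-map (π ⟨$⟩ʳ_) h a) ψ

-- σ ∘ₚ flip (S σ) sends a to the position in S σ of the value σ(a), so the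
-- order it induces is SPrec S σ by definition.
preimage-definable : (S : SortingOp) → DefinableOp S →
  (T : PermSet) → Definable T → Definable (preimage S T)
preimage-definable S (φ< , φ<-defines) T (θ , θ-defines) = interpret φ< θ , λ n σ →
  ⇔-trans (θ-defines n (S σ))
    (⇔-sym (Sat-interpret φ< σ (S σ) (σ ∘ₚ flip (S σ)) (λ _ → inverseʳ (S σ))
                          (φ<-defines n σ) (λ ()) θ))

iterate-preimage-definable : (S : SortingOp) → DefinableOp S → ∀ k →
  (T : PermSet) → Definable T → Definable (preimage (iterate k S) T)
iterate-preimage-definable S S-definable zero    T T-definable = T-definable
iterate-preimage-definable S S-definable (suc k) T T-definable =
  iterate-preimage-definable S S-definable k (preimage S T)
    (preimage-definable S S-definable T T-definable)

strictlyIncreasing⇒inflationary : (f : Fin n → Fin n) → f Preserves _<_ ⟶ _<_ →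
  ∀ i → i ≤ f i
strictlyIncreasing⇒inflationary {zero}  f f-mono ()
strictlyIncreasing⇒inflationary {suc n} f f-mono =
  <-weakInduction (λ i → i ≤ f i) z≤n step
  where
  step : ∀ i → inject₁ i ≤ f (inject₁ i) → suc i ≤ f (suc i)
  step i ih = ℕ.≤-<-trans (ℕ.≤-trans (ℕ.≤-reflexive (sym (toℕ-inject₁ i))) ih)
                          (f-mono (≤̄⇒inject₁< ≤-refl))

inverse-strictlyIncreasing : (σ : Permutation′ n) → (σ ⟨$⟩ʳ_) Preserves _<_ ⟶ _<_ →
  (σ ⟨$⟩ˡ_) Preserves _<_ ⟶ _<_
inverse-strictlyIncreasing σ σ-mono {i} {j} i<j with <-cmp (σ ⟨$⟩ˡ i) (σ ⟨$⟩ˡ j)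
... | tri< σ⁻¹i<σ⁻¹j _ _ = σ⁻¹i<σ⁻¹j
... | tri≈ _ σ⁻¹i≡σ⁻¹j _ =
  ⊥-elim (<-irrefl (trans (sym (inverseʳ σ)) (trans (cong (σ ⟨$⟩ʳ_) σ⁻¹i≡σ⁻¹j) (inverseʳ σ)))
                   i<j)
... | tri> _ _ σ⁻¹j<σ⁻¹i =
  ⊥-elim (<-asym i<j (subst₂ _<_ (inverseʳ σ) (inverseʳ σ) (σ-mono σ⁻¹j<σ⁻¹i)))

strictlyIncreasing⇒identity : (σ : Permutation′ n) → (σ ⟨$⟩ʳ_) Preserves _<_ ⟶ _<_ →
  ∀ i → σ ⟨$⟩ʳ i ≡ i
strictlyIncreasing⇒identity σ σ-mono i =
  ≤-antisym σi≤i (strictlyIncreasing⇒inflationary _ σ-mono i)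
  where
  σi≤i : σ ⟨$⟩ʳ i ≤ i
  σi≤i = subst (σ ⟨$⟩ʳ i ≤_) (inverseˡ σ)
    (strictlyIncreasing⇒inflationary _ (inverse-strictlyIncreasing σ σ-mono) (σ ⟨$⟩ʳ i))

-- ∃x (x = x) ∧ ∀x ∀y (x <P y ⇒ x <V y), in de Bruijn indices.
increasingSentence : Sentence
increasingSentence = ∃f (zero ≐ zero) ∧f ∀f (∀f ((suc zero <P zero) ⇒f (suc zero <V zero)))

increasing-definable : Definable Increasing
increasing-definable = increasingSentence , λ n σ → mk⇔ (sound n σ) (complete n σ)
  where
  sound : ∀ n (σ : Permutation′ n) → Increasing σ → Models σ increasingSentence
  sound (suc n) σ (_ , σ≗id) =
    (zero , refl) , λ a b → subst₂ _<_ (sym (σ≗id a)) (sym (σ≗id b))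
  complete : ∀ n (σ : Permutation′ n) → Models σ increasingSentence → Increasing σ
  complete (suc n) σ (_ , σ-mono) = s≤s z≤n , strictlyIncreasing⇒identity σ (σ-mono _ _)

proposition3p13 : (S : SortingOp) → DefinableOp S →
    ((T : PermSet) → Definable T → Definable (preimage S T))
    × ((k : ℕ) → k ≥ 1 → Definable (Sortable S k))
proposition3p13 S S-definable =
  preimage-definable S S-definable ,
  λ k _ → iterate-preimage-definable S S-definable k Increasing increasing-definable
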